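{- Let $k\ge3$ and let $u,v$ be two different factors of $\mathbf{t}$ of the same length $n\le 2^k-1$ which have no non-empty common prefix and no non-empty common suffix. Then $u\nsim_k v$.
   Context: $\varphi(0)=01$, $\varphi(1)=10$, and $\mathbf{t}$ is the fixed point of $\varphi$ starting with $0$. A factor is a block of consecutive letters. $\binom{u}{x}$ is the number of occurrences of $x$ as a subword (subsequence) of $u$; $u\sim_k v$ means $\binom{u}{x}=\binom{v}{x}$ for all words $x$ over $\{0,1\}$ of length at most $k$. -}

module Defs where

open import Data.Bool using (Bool; true; false; not)
open import Data.Nat using (ℕ; zero; suc; _+_; _≤_)
open import Data.List using (List; []; _∷_; _++_; concatMap; map; length; upTo)
open import Relation.Binary.PropositionalEquality using (_≡_)
open import Data.Product using (∃; _×_)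
open import Relation.Nullary using (yes; no)
import Data.Bool as B

-- binary alphabet: false = 0, true = 1

φ : List Bool → List Bool
φ = concatMap (λ a → a ∷ not a ∷ [])

φ^ : ℕ → List Bool → List Bool
φ^ zero w = w
φ^ (suc m) w = φ (φ^ m w)

-- index into a list with default value (default is never used below)
nth : List Bool → ℕ → Bool
nth [] _ = false
nth (a ∷ w) zero = a
nth (a ∷ w) (suc i) = nth w i

-- t(i): the i-th letter of the fixed point of φ starting with 0;
-- φ^(i+1)(0) is a prefix of t of length 2^(i+1) > i
t : ℕ → Bool
t i = nth (φ^ (suc i) (false ∷ [])) i

factorAt : ℕ → ℕ → List Bool
factorAt i n = map (λ j → t (i + j)) (upTo n)

IsFactor : List Bool → Set
IsFactor u = ∃ λ i → u ≡ factorAt i (length u)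

binom : List Bool → List Bool → ℕ
binom u [] = 1
binom [] (_ ∷ _) = 0
binom (a ∷ u) (b ∷ x) with a B.≟ b
... | yes _ = binom u x + binom u (b ∷ x)
... | no _ = binom u (b ∷ x)

_∼[_]_ : List Bool → ℕ → List Bool → Set
u ∼[ k ] v = (x : List Bool) → length x ≤ k → binom u x ≡ binom v x

CommonPrefix : List Bool → List Bool → Set
CommonPrefix u v = ∃ λ a → ∃ λ u' → ∃ λ v' →
  (u ≡ a ∷ u') × (v ≡ a ∷ v')

CommonSuffix : List Bool → List Bool → Set
CommonSuffix u v = ∃ λ a → ∃ λ u' → ∃ λ v' →
  (u ≡ u' ++ a ∷ []) × (v ≡ v' ++ a ∷ [])

module Submission where

-- Reading a binary word u through its 1s, the coefficient C(|u|-1-i, j) summed over the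
-- positions i of 1s in u counts the occurrences of the subwords 1w with |w| = j; so u ∼_k v
-- makes these moments of u and v agree for j < k. We show that two factors t[p, p+n) and
-- t[q, q+n) with n < 2^k and agreeing moments are equal, by induction on k and n. Equal first
-- or last letters are stripped off. Otherwise, depending on the parities of p, q and n, both
-- factors are images under φ with at most one extra letter at each end, and the moments of
-- order 0 and 1 force equal first or last letters, a contradiction; the one exception is p, q
-- and n all even, where both factors are φ-images of factors of length n/2, whose moments of
-- order < k-1 agree: the moment of order j+1 of φ(e) is, up to a term depending on |e| only,
-- the moment of order j of e with zeros interleaved, i.e. of e(z²) read as a polynomial.

open import Defs
import Algebra.Properties.CommutativeSemigroup as CommutativeSemigroupProperties
open import Data.Bool using (Bool; true; false; not; _≟_)
open import Data.Empty using (⊥-elim)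
open import Data.List using (List; []; _∷_; _++_; _∷ʳ_; concatMap; length; map; applyUpTo)
open import Data.List.Properties using (map-applyUpTo; map-++; length-++; length-map)
open import Data.Nat using (ℕ; zero; suc; pred; _+_; _*_; _∸_; _≤_; _<_; _^_; z≤n; s≤s; z<s)
open import Data.Nat.Combinatorics using (_C_; nCk+nC[k+1]≡[n+1]C[k+1]; nC1≡n)
open import Data.Nat.Properties
  using (+-suc; +-identityʳ; +-comm; +-assoc; +-cancelˡ-≡; +-cancelʳ-≡; +-mono-≤; +-monoʳ-≤; +-monoʳ-<;
         *-identityˡ; *-identityʳ; *-zeroʳ; *-cancelˡ-≡; ≤-trans; ≤-<-trans; <⇒≤; <⇒≢; n≤1+n; m≤n⇒m≤1+n;
         m≤m+n; m≤n+m; m<m+n; m≤o∸n⇒m+n≤o; m^n>0; ^-monoʳ-≤; +-commutativeSemigroup; module ≤-Reasoning)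
open import Data.Nat.Tactic.RingSolver using (solve-∀)
open import Data.Product using (_,_)
open import Function using (id; _∘_)
open import Relation.Binary.PropositionalEquality
open import Relation.Nullary using (yes; no; ¬_)

open CommutativeSemigroupProperties +-commutativeSemigroup using (interchange; x∙yz≈y∙xz)

-- The Thue–Morse word and its factors

double : ℕ → ℕ
double zero = zero
double (suc n) = suc (suc (double n))

double≡+ : ∀ n → double n ≡ n + n
double≡+ zero = refl
double≡+ (suc n) = cong suc (trans (cong suc (double≡+ n)) (sym (+-suc n n)))

2^suc≡double : ∀ n → 2 ^ suc n ≡ double (2 ^ n)
2^suc≡double n = trans (cong (2 ^ n +_) (+-identityʳ (2 ^ n))) (sym (double≡+ (2 ^ n)))

n<2^n : ∀ n → n < 2 ^ n
n<2^n zero = s≤s z≤n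
n<2^n (suc n) = +-mono-≤ (m^n>0 2 n) (≤-trans (n<2^n n) (m≤m+n (2 ^ n) 0))

n<2^[1+n] : ∀ n → n < 2 ^ suc n
n<2^[1+n] n = ≤-trans (n<2^n n) (^-monoʳ-≤ 2 (n≤1+n n))

suc-double-mono-< : ∀ {i n} → i < n → suc (double i) < double n
suc-double-mono-< {zero} {suc n} _ = s≤s (s≤s z≤n)
suc-double-mono-< {suc i} {suc n} (s≤s i<n) = s≤s (s≤s (suc-double-mono-< i<n))

double-cancel-< : ∀ {m n} → double m < double n → m < n
double-cancel-< {zero} {suc n} _ = z<s
double-cancel-< {suc m} {suc n} (s≤s (s≤s lt)) = s≤s (double-cancel-< lt)

data Parity : ℕ → Set where
  even : ∀ a → Parity (double a)
  odd  : ∀ a → Parity (suc (double a))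

parity : ∀ n → Parity n
parity zero = even zero
parity (suc n) with parity n
... | even a = odd a
... | odd a = even (suc a)

φ-++ : ∀ x y → φ (x ++ y) ≡ φ x ++ φ y
φ-++ [] y = refl
φ-++ (a ∷ x) y = cong (λ z → a ∷ not a ∷ z) (φ-++ x y)

φ^-++ : ∀ i x y → φ^ i (x ++ y) ≡ φ^ i x ++ φ^ i y
φ^-++ zero x y = refl
φ^-++ (suc i) x y = trans (cong φ (φ^-++ i x y)) (φ-++ (φ^ i x) (φ^ i y))

φ^-φ : ∀ i w → φ^ i (φ w) ≡ φ (φ^ i w)
φ^-φ zero w = refl
φ^-φ (suc i) w = cong φ (φ^-φ i w)

length-φ : ∀ w → length (φ w) ≡ double (length w)
length-φ [] = refl
length-φ (a ∷ w) = cong (λ l → suc (suc l)) (length-φ w)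

nth-++ˡ : ∀ x y {i} → i < length x → nth (x ++ y) i ≡ nth x i
nth-++ˡ (a ∷ x) y {zero} _ = refl
nth-++ˡ (a ∷ x) y {suc i} (s≤s i<) = nth-++ˡ x y i<

nth-φ-double : ∀ w {i} → i < length w → nth (φ w) (double i) ≡ nth w i
nth-φ-double (a ∷ w) {zero} _ = refl
nth-φ-double (a ∷ w) {suc i} (s≤s i<) = nth-φ-double w i<

nth-φ-suc-double : ∀ w {i} → i < length w → nth (φ w) (suc (double i)) ≡ not (nth w i)
nth-φ-suc-double (a ∷ w) {zero} _ = refl
nth-φ-suc-double (a ∷ w) {suc i} (s≤s i<) = nth-φ-suc-double w i<

block : ℕ → List Bool
block c = φ^ c (false ∷ [])

block-suc : ∀ c → block (suc c) ≡ block c ++ φ^ c (true ∷ [])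
block-suc c = trans (sym (φ^-φ c (false ∷ []))) (φ^-++ c (false ∷ []) (true ∷ []))

length-block : ∀ c → length (block c) ≡ 2 ^ c
length-block zero = refl
length-block (suc c) = trans (length-φ (block c)) (trans (cong double (length-block c)) (sym (2^suc≡double c)))

nth-block-+ : ∀ d c {i} → i < 2 ^ c → nth (block (d + c)) i ≡ nth (block c) i
nth-block-+ zero c i< = refl
nth-block-+ (suc d) c {i} i< = begin
  nth (block (suc d + c)) i               ≡⟨ cong (λ w → nth w i) (block-suc (d + c)) ⟩
  nth (block (d + c) ++ φ^ (d + c) _) i   ≡⟨ nth-++ˡ (block (d + c)) _ i<length ⟩
  nth (block (d + c)) i                   ≡⟨ nth-block-+ d c i< ⟩
  nth (block c) i                         ∎
  where
  open ≡-Reasoning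
  i<length : i < length (block (d + c))
  i<length = subst (i <_) (sym (length-block (d + c))) (≤-trans i< (^-monoʳ-≤ 2 (m≤n+m c d)))

nth-block≡t : ∀ c {i} → i < 2 ^ c → nth (block c) i ≡ t i
nth-block≡t c {i} i< = begin
  nth (block c) i            ≡⟨ nth-block-+ (suc i) c i< ⟨
  nth (block (suc i + c)) i  ≡⟨ cong (λ d → nth (block d) i) (+-comm (suc i) c) ⟩
  nth (block (c + suc i)) i  ≡⟨ nth-block-+ c (suc i) (n<2^[1+n] i) ⟩
  t i                        ∎
  where open ≡-Reasoning

module _ (a : ℕ) where
  private
    a<length : a < length (block (suc a))
    a<length = subst (a <_) (sym (length-block (suc a))) (n<2^[1+n] a)

    suc-double<2^ : suc (double a) < 2 ^ suc (suc a)
    suc-double<2^ = subst (suc (double a) <_) (sym (2^suc≡double (suc a)))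
      (suc-double-mono-< (n<2^[1+n] a))

  t-double : t (double a) ≡ t a
  t-double = trans (sym (nth-block≡t (suc (suc a)) (≤-trans (n≤1+n _) suc-double<2^)))
    (nth-φ-double (block (suc a)) a<length)

  t-suc-double : t (suc (double a)) ≡ not (t a)
  t-suc-double = trans (sym (nth-block≡t (suc (suc a)) suc-double<2^))
    (nth-φ-suc-double (block (suc a)) a<length)

window : ℕ → ℕ → List Bool
window p zero = []
window p (suc n) = t p ∷ window (suc p) n

length-window : ∀ p n → length (window p n) ≡ n
length-window p zero = refl
length-window p (suc n) = cong suc (length-window (suc p) n)

applyUpTo≡window : ∀ p n (f : ℕ → Bool) → (∀ j → f j ≡ t (p + j)) → applyUpTo f n ≡ window p n
applyUpTo≡window p zero f f≗ = refl
applyUpTo≡window p (suc n) f f≗ = cong₂ _∷_ (trans (f≗ 0) (cong t (+-identityʳ p)))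
  (applyUpTo≡window (suc p) n (λ j → f (suc j)) (λ j → trans (f≗ (suc j)) (cong t (+-suc p j))))

factorAt≡window : ∀ p n → factorAt p n ≡ window p n
factorAt≡window p n = trans (map-applyUpTo id _ n) (applyUpTo≡window p n _ (λ _ → refl))

window-∷ʳ : ∀ p n → window p (suc n) ≡ window p n ∷ʳ t (p + n)
window-∷ʳ p zero = cong (λ i → t i ∷ []) (sym (+-identityʳ p))
window-∷ʳ p (suc n) = cong (t p ∷_) (trans (window-∷ʳ (suc p) n) (cong (λ i → window (suc p) n ∷ʳ t i) (sym (+-suc p n))))

window-double : ∀ a m → window (double a) (double m) ≡ φ (window a m)
window-double a zero = refl
window-double a (suc m) = trans
  (cong₂ (λ x y → x ∷ y ∷ window (double (suc a)) (double m)) (t-double a) (t-suc-double a))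
  (cong (λ w → t a ∷ not (t a) ∷ w) (window-double (suc a) m))

-- Moments of coefficient lists

pascal : ∀ n j → suc n C suc j ≡ n C j + n C suc j
pascal n j = sym (nCk+nC[k+1]≡[n+1]C[k+1] n j)

moment : ℕ → List ℕ → ℕ
moment j [] = 0
moment j (a ∷ x) = a * (length x C j) + moment j x

MomentsAgree : ℕ → List ℕ → List ℕ → Set
MomentsAgree k x y = ∀ j → j < k → moment j x ≡ moment j y

momentsAgree-∷⁻ : ∀ {k} a x y → length x ≡ length y →
  MomentsAgree k (a ∷ x) (a ∷ y) → MomentsAgree k x y
momentsAgree-∷⁻ a x y |x|≡|y| agree j j<k = +-cancelˡ-≡ (a * (length x C j)) _ _
  (trans (agree j j<k) (cong (λ l → a * (l C j) + moment j y) (sym |x|≡|y|)))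

moment-zero-∷ʳ : ∀ x a → moment 0 (x ∷ʳ a) ≡ moment 0 x + a
moment-zero-∷ʳ [] a = trans (+-identityʳ (a * 1)) (*-identityʳ a)
moment-zero-∷ʳ (b ∷ x) a = trans (cong (b * 1 +_) (moment-zero-∷ʳ x a)) (sym (+-assoc (b * 1) (moment 0 x) a))

moment-suc-∷ʳ : ∀ j x a → moment (suc j) (x ∷ʳ a) ≡ moment (suc j) x + moment j x
moment-suc-∷ʳ j [] a = trans (+-identityʳ (a * 0)) (*-zeroʳ a)
moment-suc-∷ʳ j (b ∷ x) a
  rewrite moment-suc-∷ʳ j x a | length-++ x {a ∷ []} | +-comm (length x) 1 | pascal (length x) j =
  regroup b (length x C j) (length x C suc j) (moment (suc j) x) (moment j x)
  where
  regroup : ∀ b c c′ r s → b * (c + c′) + (r + s) ≡ (b * c′ + r) + (b * c + s)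
  regroup = solve-∀

momentsAgree-∷ʳ⁻ : ∀ {k} x y a → MomentsAgree k (x ∷ʳ a) (y ∷ʳ a) → MomentsAgree k x y
momentsAgree-∷ʳ⁻ x y a agree zero j<k = +-cancelʳ-≡ a _ _
  (trans (sym (moment-zero-∷ʳ x a)) (trans (agree 0 j<k) (moment-zero-∷ʳ y a)))
momentsAgree-∷ʳ⁻ x y a agree (suc j) j<k = +-cancelʳ-≡ (moment j x) _ _ (begin
  moment (suc j) x + moment j x  ≡⟨ moment-suc-∷ʳ j x a ⟨
  moment (suc j) (x ∷ʳ a)        ≡⟨ agree (suc j) j<k ⟩
  moment (suc j) (y ∷ʳ a)        ≡⟨ moment-suc-∷ʳ j y a ⟩
  moment (suc j) y + moment j y  ≡⟨ cong (moment (suc j) y +_) (momentsAgree-∷ʳ⁻ x y a agree j (<⇒≤ j<k)) ⟨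
  moment (suc j) y + moment j x  ∎)
  where open ≡-Reasoning

moment-one-∷ : ∀ a x → moment 1 (a ∷ x) ≡ a * length x + moment 1 x
moment-one-∷ a x = cong (λ c → a * c + moment 1 x) (nC1≡n (length x))

length<2⇒moment-one≡0 : ∀ x → length x < 2 → moment 1 x ≡ 0
length<2⇒moment-one≡0 [] _ = refl
length<2⇒moment-one≡0 (a ∷ []) _ = trans (+-identityʳ (a * 0)) (*-zeroʳ a)
length<2⇒moment-one≡0 (a ∷ b ∷ x) (s≤s (s≤s ()))

momentsAgree-two : ∀ k x y → length x < 2 ^ k → length y < 2 ^ k → MomentsAgree k x y → MomentsAgree 2 x y
momentsAgree-two zero [] [] _ _ _ j _ = refl
momentsAgree-two zero (_ ∷ _) _ (s≤s ())
momentsAgree-two zero [] (_ ∷ _) _ (s≤s ())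
momentsAgree-two 1 x y _ _ agree zero _ = agree 0 z<s
momentsAgree-two 1 x y |x|<2 |y|<2 _ 1 _ = trans (length<2⇒moment-one≡0 x |x|<2) (sym (length<2⇒moment-one≡0 y |y|<2))
momentsAgree-two 1 x y _ _ _ (suc (suc j)) (s≤s (s≤s ()))
momentsAgree-two (suc (suc k)) x y _ _ agree j j<2 = agree j (≤-trans j<2 (s≤s (s≤s z≤n)))

-- Binomial equivalence and moments

bit : Bool → ℕ
bit false = 0
bit true = 1

bits : List Bool → List ℕ
bits = map bit

sumOverWords : ℕ → (List Bool → ℕ) → ℕ
sumOverWords zero f = f []
sumOverWords (suc j) f = sumOverWords j (λ w → f (false ∷ w)) + sumOverWords j (λ w → f (true ∷ w))

sumOverWords-cong : ∀ j {f g : List Bool → ℕ} → (∀ w → length w ≡ j → f w ≡ g w) →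
  sumOverWords j f ≡ sumOverWords j g
sumOverWords-cong zero f≗g = f≗g [] refl
sumOverWords-cong (suc j) f≗g = cong₂ _+_
  (sumOverWords-cong j (λ w |w|≡j → f≗g (false ∷ w) (cong suc |w|≡j)))
  (sumOverWords-cong j (λ w |w|≡j → f≗g (true ∷ w) (cong suc |w|≡j)))

sumOverWords-+ : ∀ j (f g : List Bool → ℕ) → sumOverWords j (λ w → f w + g w) ≡ sumOverWords j f + sumOverWords j g
sumOverWords-+ zero f g = refl
sumOverWords-+ (suc j) f g = trans
  (cong₂ _+_ (sumOverWords-+ j (λ w → f (false ∷ w)) (λ w → g (false ∷ w)))
             (sumOverWords-+ j (λ w → f (true ∷ w)) (λ w → g (true ∷ w))))
  (interchange (sumOverWords j (λ w → f (false ∷ w))) (sumOverWords j (λ w → g (false ∷ w)))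
               (sumOverWords j (λ w → f (true ∷ w))) (sumOverWords j (λ w → g (true ∷ w))))

sumOverWords-zero : ∀ j → sumOverWords j (λ _ → 0) ≡ 0
sumOverWords-zero zero = refl
sumOverWords-zero (suc j) = cong₂ _+_ (sumOverWords-zero j) (sumOverWords-zero j)

sumOverWords-binom : ∀ u j → sumOverWords j (binom u) ≡ length u C j
sumOverWords-binom u zero = refl
sumOverWords-binom [] (suc j) = cong₂ _+_ (sumOverWords-zero j) (sumOverWords-zero j)
sumOverWords-binom (a ∷ u) (suc j) = begin
  sumOverWords j (λ w → binom (a ∷ u) (false ∷ w)) + sumOverWords j (λ w → binom (a ∷ u) (true ∷ w))
    ≡⟨ split a ⟩
  sumOverWords j (binom u) + sumOverWords (suc j) (binom u)
    ≡⟨ cong₂ _+_ (sumOverWords-binom u j) (sumOverWords-binom u (suc j)) ⟩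
  length u C j + length u C suc j
    ≡⟨ pascal (length u) j ⟨
  suc (length u) C suc j  ∎
  where
  open ≡-Reasoning
  S₀ S₁ : ℕ
  S₀ = sumOverWords j (λ w → binom u (false ∷ w))
  S₁ = sumOverWords j (λ w → binom u (true ∷ w))
  split : ∀ a → sumOverWords j (λ w → binom (a ∷ u) (false ∷ w)) + sumOverWords j (λ w → binom (a ∷ u) (true ∷ w))
              ≡ sumOverWords j (binom u) + (S₀ + S₁)
  split false = trans (cong (_+ S₁) (sumOverWords-+ j (binom u) (λ w → binom u (false ∷ w))))
                      (+-assoc (sumOverWords j (binom u)) S₀ S₁)
  split true = trans (cong (S₀ +_) (sumOverWords-+ j (binom u) (λ w → binom u (true ∷ w))))
                     (x∙yz≈y∙xz S₀ (sumOverWords j (binom u)) S₁)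

moment-bits : ∀ j u → moment j (bits u) ≡ sumOverWords j (λ w → binom u (true ∷ w))
moment-bits j [] = sym (sumOverWords-zero j)
moment-bits j (false ∷ u) = moment-bits j u
moment-bits j (true ∷ u) = begin
  1 * (length (bits u) C j) + moment j (bits u)
    ≡⟨ cong₂ _+_ (trans (*-identityˡ _) (cong (_C j) (length-map bit u))) (moment-bits j u) ⟩
  length u C j + sumOverWords j (λ w → binom u (true ∷ w))
    ≡⟨ cong (_+ sumOverWords j (λ w → binom u (true ∷ w))) (sumOverWords-binom u j) ⟨
  sumOverWords j (binom u) + sumOverWords j (λ w → binom u (true ∷ w))
    ≡⟨ sumOverWords-+ j (binom u) (λ w → binom u (true ∷ w)) ⟨
  sumOverWords j (λ w → binom u w + binom u (true ∷ w))  ∎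
  where open ≡-Reasoning

∼⇒momentsAgree : ∀ {k u v} → u ∼[ k ] v → MomentsAgree k (bits u) (bits v)
∼⇒momentsAgree {k} {u} {v} u∼v j j<k = begin
  moment j (bits u)                                ≡⟨ moment-bits j u ⟩
  sumOverWords j (λ w → binom u (true ∷ w))        ≡⟨ sumOverWords-cong j (λ w |w|≡j → u∼v (true ∷ w) (|1w|≤k |w|≡j)) ⟩
  sumOverWords j (λ w → binom v (true ∷ w))        ≡⟨ moment-bits j v ⟨
  moment j (bits v)                                ∎
  where
  open ≡-Reasoning
  |1w|≤k : ∀ {l} → l ≡ j → suc l ≤ k
  |1w|≤k l≡j = subst (λ l → suc l ≤ k) (sym l≡j) j<k

-- Moments of images under φ

spread : List ℕ → List ℕ
spread [] = []
spread (a ∷ x) = a ∷ concatMap (λ b → 0 ∷ b ∷ []) x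

duplicate : List ℕ → List ℕ
duplicate [] = []
duplicate (a ∷ x) = a ∷ a ∷ duplicate x

partialSums : ℕ → List ℕ → List ℕ
partialSums c [] = []
partialSums c (a ∷ []) = []
partialSums c (a ∷ b ∷ x) = c + a ∷ partialSums (c + a) (b ∷ x)

length-spread-∷ : ∀ a x → length (spread (a ∷ x)) ≡ suc (double (length x))
length-spread-∷ a [] = refl
length-spread-∷ a (b ∷ x) = cong (λ l → suc (suc l)) (length-spread-∷ b x)

length-duplicate : ∀ x → length (duplicate x) ≡ double (length x)
length-duplicate [] = refl
length-duplicate (a ∷ x) = cong (λ l → suc (suc l)) (length-duplicate x)

length-partialSums-∷ : ∀ c a x → length (partialSums c (a ∷ x)) ≡ length x
length-partialSums-∷ c a [] = refl
length-partialSums-∷ c a (b ∷ x) = cong suc (length-partialSums-∷ (c + a) b x)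

moment-spread-∷ : ∀ j a x → moment j (spread (a ∷ x)) ≡ a * (double (length x) C j) + moment j (spread x)
moment-spread-∷ j a [] = refl
moment-spread-∷ j a (b ∷ x) = cong (λ l → a * (suc l C j) + moment j (spread (b ∷ x))) (length-spread-∷ b x)

moment-zero-spread : ∀ x → moment 0 (spread x) ≡ moment 0 x
moment-zero-spread [] = refl
moment-zero-spread (a ∷ x) = trans (moment-spread-∷ 0 a x) (cong (a * 1 +_) (moment-zero-spread x))

moment-zero-duplicate : ∀ x → moment 0 (duplicate x) ≡ 2 * moment 0 (spread x)
moment-zero-duplicate [] = refl
moment-zero-duplicate (a ∷ x) rewrite moment-spread-∷ 0 a x | moment-zero-duplicate x =
  regroup a (moment 0 (spread x))
  where
  regroup : ∀ a r → a * 1 + (a * 1 + 2 * r) ≡ 2 * (a * 1 + r)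
  regroup = solve-∀

moment-suc-duplicate : ∀ j x → moment (suc j) (duplicate x) ≡ 2 * moment (suc j) (spread x) + moment j (spread x)
moment-suc-duplicate j [] = refl
moment-suc-duplicate j (a ∷ x)
  rewrite moment-spread-∷ j a x | moment-spread-∷ (suc j) a x | moment-suc-duplicate j x
        | length-duplicate x | pascal (double (length x)) j =
  regroup a (double (length x) C j) (double (length x) C suc j) (moment (suc j) (spread x)) (moment j (spread x))
  where
  regroup : ∀ a c c′ r s → a * (c + c′) + (a * c′ + (2 * r + s)) ≡ 2 * (a * c′ + r) + (a * c + s)
  regroup = solve-∀

moment-partialSums : ∀ j c x → moment j (partialSums c x) ≡ c * (pred (length x) C suc j) + moment (suc j) x
moment-partialSums j c [] = sym (trans (+-identityʳ (c * 0)) (*-zeroʳ c))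
moment-partialSums j c (a ∷ []) = vanish c a
  where
  vanish : ∀ c a → 0 ≡ c * 0 + (a * 0 + 0)
  vanish = solve-∀
moment-partialSums j c (a ∷ b ∷ x) = begin
  (c + a) * (length (partialSums (c + a) (b ∷ x)) C j) + moment j (partialSums (c + a) (b ∷ x))
    ≡⟨ cong₂ (λ l r → (c + a) * (l C j) + r) (length-partialSums-∷ (c + a) b x) (moment-partialSums j (c + a) (b ∷ x)) ⟩
  (c + a) * (length x C j) + ((c + a) * (length x C suc j) + moment (suc j) (b ∷ x))
    ≡⟨ regroup c a (length x C j) (length x C suc j) (moment (suc j) (b ∷ x)) ⟩
  c * (length x C j + length x C suc j) + (a * (length x C j + length x C suc j) + moment (suc j) (b ∷ x))
    ≡⟨ cong (λ k → c * k + (a * k + moment (suc j) (b ∷ x))) (pascal (length x) j) ⟨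
  c * (suc (length x) C suc j) + (a * (suc (length x) C suc j) + moment (suc j) (b ∷ x))  ∎
  where
  open ≡-Reasoning
  regroup : ∀ c a k k′ r → (c + a) * k + ((c + a) * k′ + r) ≡ c * (k + k′) + (a * (k + k′) + r)
  regroup = solve-∀

partialSums-spread : ∀ c x → partialSums c (spread x) ≡ duplicate (partialSums c x)
partialSums-spread c [] = refl
partialSums-spread c (a ∷ []) = refl
partialSums-spread c (a ∷ b ∷ x) =
  trans (cong (λ s → c + a ∷ s ∷ partialSums s (spread (b ∷ x))) (+-identityʳ (c + a)))
        (cong (λ s → c + a ∷ c + a ∷ s) (partialSums-spread (c + a) (b ∷ x)))

momentsAgree-duplicate⁻ : ∀ {k} x y → MomentsAgree k (duplicate x) (duplicate y) → MomentsAgree k (spread x) (spread y)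
momentsAgree-duplicate⁻ x y agree zero j<k = *-cancelˡ-≡ _ _ 2
  (trans (sym (moment-zero-duplicate x)) (trans (agree 0 j<k) (moment-zero-duplicate y)))
momentsAgree-duplicate⁻ x y agree (suc j) j<k = *-cancelˡ-≡ _ _ 2 (+-cancelʳ-≡ (moment j (spread x)) _ _ (begin
  2 * moment (suc j) (spread x) + moment j (spread x)  ≡⟨ moment-suc-duplicate j x ⟨
  moment (suc j) (duplicate x)                         ≡⟨ agree (suc j) j<k ⟩
  moment (suc j) (duplicate y)                         ≡⟨ moment-suc-duplicate j y ⟩
  2 * moment (suc j) (spread y) + moment j (spread y)
    ≡⟨ cong (2 * moment (suc j) (spread y) +_) (momentsAgree-duplicate⁻ x y agree j (<⇒≤ j<k)) ⟨
  2 * moment (suc j) (spread y) + moment j (spread x)  ∎))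
  where open ≡-Reasoning

-- Moments of order j+1 of x are moments of order j of its partial sums, and the partial sums
-- of spread x are those of x duplicated; duplication is undone order by order.
momentsAgree-spread⁻ : ∀ k x y → MomentsAgree k (spread x) (spread y) → MomentsAgree k x y
momentsAgree-spread⁻ (suc k) x y agree zero _ =
  trans (sym (moment-zero-spread x)) (trans (agree 0 z<s) (moment-zero-spread y))
momentsAgree-spread⁻ (suc k) x y agree (suc j) (s≤s j<k) = begin
  moment (suc j) x            ≡⟨ moment-partialSums j 0 x ⟨
  moment j (partialSums 0 x)  ≡⟨ momentsAgree-spread⁻ k sx sy (momentsAgree-duplicate⁻ sx sy sumsAgree) j j<k ⟩
  moment j (partialSums 0 y)  ≡⟨ moment-partialSums j 0 y ⟩
  moment (suc j) y            ∎
  where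
  open ≡-Reasoning
  sx sy : List ℕ
  sx = partialSums 0 x
  sy = partialSums 0 y
  sumsAgree : MomentsAgree k (duplicate sx) (duplicate sy)
  sumsAgree i i<k = begin
    moment i (duplicate (partialSums 0 x))  ≡⟨ cong (moment i) (partialSums-spread 0 x) ⟨
    moment i (partialSums 0 (spread x))     ≡⟨ moment-partialSums i 0 (spread x) ⟩
    moment (suc i) (spread x)               ≡⟨ agree (suc i) (s≤s i<k) ⟩
    moment (suc i) (spread y)               ≡⟨ moment-partialSums i 0 (spread y) ⟨
    moment i (partialSums 0 (spread y))     ≡⟨ cong (moment i) (partialSums-spread 0 y) ⟩
    moment i (duplicate (partialSums 0 y))  ∎

φ-correction : ℕ → ℕ → ℕ
φ-correction j zero = 0
φ-correction j (suc l) = double l C suc j + φ-correction j l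

length-bits-φ : ∀ e → length (bits (φ e)) ≡ double (length e)
length-bits-φ e = trans (length-map bit (φ e)) (length-φ e)

moment-suc-φ : ∀ j e → moment (suc j) (bits (φ e)) ≡ moment j (spread (bits e)) + φ-correction j (length e)
moment-suc-φ j [] = refl
moment-suc-φ j (a ∷ e) = begin
  bit a * (suc L C suc j) + (bit (not a) * (L C suc j) + moment (suc j) (bits (φ e)))
    ≡⟨ cong₂ (λ L r → bit a * (suc L C suc j) + (bit (not a) * (L C suc j) + r)) (length-bits-φ e) (moment-suc-φ j e) ⟩
  bit a * (suc (double l) C suc j) + (bit (not a) * (double l C suc j) + (r + φ-correction j l))
    ≡⟨ cong (λ c → bit a * c + (bit (not a) * (double l C suc j) + (r + φ-correction j l))) (pascal (double l) j) ⟩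
  bit a * (double l C j + double l C suc j) + (bit (not a) * (double l C suc j) + (r + φ-correction j l))
    ≡⟨ regroup a (double l C j) (double l C suc j) r (φ-correction j l) ⟩
  (bit a * (double l C j) + r) + (double l C suc j + φ-correction j l)
    ≡⟨ cong (λ l′ → bit a * (double l′ C j) + r + (double l C suc j + φ-correction j l)) (length-map bit e) ⟨
  (bit a * (double (length (bits e)) C j) + r) + (double l C suc j + φ-correction j l)
    ≡⟨ cong (_+ (double l C suc j + φ-correction j l)) (moment-spread-∷ j (bit a) (bits e)) ⟨
  moment j (spread (bits (a ∷ e))) + φ-correction j (suc l)  ∎
  where
  open ≡-Reasoning
  L l r : ℕ
  L = length (bits (φ e))
  l = length e
  r = moment j (spread (bits e))
  regroup : ∀ a c c′ r s → bit a * (c + c′) + (bit (not a) * c′ + (r + s)) ≡ (bit a * c + r) + (c′ + s)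
  regroup false = solve-∀
  regroup true = solve-∀

momentsAgree-φ⁻ : ∀ k e f → length e ≡ length f →
  MomentsAgree (suc k) (bits (φ e)) (bits (φ f)) → MomentsAgree k (bits e) (bits f)
momentsAgree-φ⁻ k e f |e|≡|f| agree = momentsAgree-spread⁻ k (bits e) (bits f) λ j j<k →
  +-cancelʳ-≡ (φ-correction j (length e)) _ _ (begin
    moment j (spread (bits e)) + φ-correction j (length e)  ≡⟨ moment-suc-φ j e ⟨
    moment (suc j) (bits (φ e))                             ≡⟨ agree (suc j) (s≤s j<k) ⟩
    moment (suc j) (bits (φ f))                             ≡⟨ moment-suc-φ j f ⟩
    moment j (spread (bits f)) + φ-correction j (length f)  ≡⟨ cong (λ l → _ + φ-correction j l) |e|≡|f| ⟨
    moment j (spread (bits f)) + φ-correction j (length e)  ∎)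
  where open ≡-Reasoning

-- Factors whose end letters differ

ones : List Bool → ℕ
ones w = moment 0 (bits w)

bit-injective : ∀ {x y} → bit x ≡ bit y → x ≡ y
bit-injective {false} {false} _ = refl
bit-injective {true} {true} _ = refl

ones-φ : ∀ e → ones (φ e) ≡ length e
ones-φ [] = refl
ones-φ (false ∷ e) = cong suc (ones-φ e)
ones-φ (true ∷ e) = cong suc (ones-φ e)

ones≤length : ∀ w → ones w ≤ length w
ones≤length [] = z≤n
ones≤length (false ∷ w) = m≤n⇒m≤1+n (ones≤length w)
ones≤length (true ∷ w) = s≤s (ones≤length w)

ones-∷ : ∀ x w → ones (x ∷ w) ≡ bit x + ones w
ones-∷ x w = cong (_+ ones w) (*-identityʳ (bit x))

ones-∷ʳ : ∀ w x → ones (w ∷ʳ x) ≡ ones w + bit x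
ones-∷ʳ w x = trans (cong (moment 0) (map-++ bit w (x ∷ []))) (moment-zero-∷ʳ (bits w) (bit x))

moment-one-∷ʳ : ∀ w x → moment 1 (bits (w ∷ʳ x)) ≡ moment 1 (bits w) + ones w
moment-one-∷ʳ w x = trans (cong (moment 1) (map-++ bit w (x ∷ []))) (moment-suc-∷ʳ 0 (bits w) (bit x))

bit-φ-pair : ∀ x c → bit x * suc c + bit (not x) * c ≡ c + bit x
bit-φ-pair false = solve-∀
bit-φ-pair true = solve-∀

moment-one-φ : ∀ e → moment 1 (bits (φ e)) + length e ≡ length e * length e + ones e
moment-one-φ [] = refl
moment-one-φ (x ∷ e) = begin
  bit x * (suc L C 1) + (bit (not x) * (L C 1) + M) + suc l
    ≡⟨ cong₂ (λ c c′ → bit x * c + (bit (not x) * c′ + M) + suc l) (nC1≡n (suc L)) (nC1≡n L) ⟩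
  bit x * suc L + (bit (not x) * L + M) + suc l
    ≡⟨ cong (_+ suc l) (sym (+-assoc (bit x * suc L) _ M)) ⟩
  bit x * suc L + bit (not x) * L + M + suc l
    ≡⟨ cong (λ c → c + M + suc l) (trans (bit-φ-pair x L) (cong (_+ bit x) (trans (length-bits-φ e) (double≡+ l)))) ⟩
  l + l + bit x + M + suc l
    ≡⟨ regroup l (bit x) M ⟩
  (M + l) + (suc l + l + bit x)
    ≡⟨ cong (_+ (suc l + l + bit x)) (moment-one-φ e) ⟩
  (l * l + ones e) + (suc l + l + bit x)
    ≡⟨ square l (bit x) (ones e) ⟩
  suc l * suc l + (bit x * 1 + ones e)  ∎
  where
  open ≡-Reasoning
  L l M : ℕ
  L = length (bits (φ e))
  l = length e
  M = moment 1 (bits (φ e))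
  regroup : ∀ l b M → l + l + b + M + suc l ≡ (M + l) + (suc l + l + b)
  regroup = solve-∀
  square : ∀ l b o → (l * l + o) + (suc l + l + b) ≡ suc l * suc l + (b * 1 + o)
  square = solve-∀

ones-window-double : ∀ a m → ones (window (double a) (double m)) ≡ m
ones-window-double a m = trans (cong ones (window-double a m)) (trans (ones-φ (window a m)) (length-window a m))

moment-one-window-double : ∀ a m → moment 1 (bits (window (double a) (double m))) + m ≡ m * m + ones (window a m)
moment-one-window-double a m = begin
  moment 1 (bits (window (double a) (double m))) + m  ≡⟨ cong₂ (λ w l → moment 1 (bits w) + l) (window-double a m) (sym |w|≡m) ⟩
  moment 1 (bits (φ w)) + length w                    ≡⟨ moment-one-φ w ⟩
  length w * length w + ones w                        ≡⟨ cong (λ l → l * l + ones w) |w|≡m ⟩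
  m * m + ones w                                      ∎
  where
  open ≡-Reasoning
  w : List Bool
  w = window a m
  |w|≡m : length w ≡ m
  |w|≡m = length-window a m

ones-window≤ : ∀ p n → ones (window p n) ≤ n
ones-window≤ p n = subst (ones (window p n) ≤_) (length-window p n) (ones≤length (window p n))

ones-window-even-odd : ∀ a m → ones (window (double a) (suc (double m))) ≡ m + bit (t (double a + double m))
ones-window-even-odd a m = begin
  ones (window (double a) (suc (double m)))  ≡⟨ cong ones (window-∷ʳ (double a) (double m)) ⟩
  ones (w ∷ʳ x)                              ≡⟨ ones-∷ʳ w x ⟩
  ones w + bit x                             ≡⟨ cong (_+ bit x) (ones-window-double a m) ⟩
  m + bit x                                  ∎
  where
  open ≡-Reasoning
  w : List Bool
  w = window (double a) (double m)
  x : Bool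
  x = t (double a + double m)

ones-window-odd-odd : ∀ a m → ones (window (suc (double a)) (suc (double m))) ≡ bit (t (suc (double a))) + m
ones-window-odd-odd a m = trans (ones-∷ (t (suc (double a))) (window (double (suc a)) (double m)))
  (cong (bit (t (suc (double a))) +_) (ones-window-double (suc a) m))

moment-one-window-even-odd : ∀ a m → moment 1 (bits (window (double a) (suc (double m)))) ≡ m * m + ones (window a m)
moment-one-window-even-odd a m = begin
  moment 1 (bits (window (double a) (suc (double m))))     ≡⟨ cong (moment 1 ∘ bits) (window-∷ʳ (double a) (double m)) ⟩
  moment 1 (bits (w ∷ʳ t (double a + double m)))          ≡⟨ moment-one-∷ʳ w (t (double a + double m)) ⟩
  moment 1 (bits w) + ones w                              ≡⟨ cong (moment 1 (bits w) +_) (ones-window-double a m) ⟩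
  moment 1 (bits w) + m                                   ≡⟨ moment-one-window-double a m ⟩
  m * m + ones (window a m)                               ∎
  where
  open ≡-Reasoning
  w : List Bool
  w = window (double a) (double m)

moment-one-window-odd : ∀ a n → moment 1 (bits (window (suc (double a)) (suc n))) ≡
  bit (t (suc (double a))) * n + moment 1 (bits (window (double (suc a)) n))
moment-one-window-odd a n = trans (moment-one-∷ (bit (t (suc (double a)))) (bits w))
  (cong (λ l → bit (t (suc (double a))) * l + moment 1 (bits w)) (trans (length-map bit w) (length-window (double (suc a)) n)))
  where
  w : List Bool
  w = window (double (suc a)) n

moment-one-window-odd-odd : ∀ a m → moment 1 (bits (window (suc (double a)) (suc (double m)))) + m ≡
  bit (t (suc (double a))) * double m + (m * m + ones (window (suc a) m))
moment-one-window-odd-odd a m = trans (cong (_+ m) (moment-one-window-odd a (double m)))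
  (trans (+-assoc (bit (t (suc (double a))) * double m) (moment 1 (bits (window (double (suc a)) (double m)))) m)
         (cong (bit (t (suc (double a))) * double m +_) (moment-one-window-double (suc a) m)))

moment-one-window-odd-even : ∀ a l → moment 1 (bits (window (suc (double a)) (suc (suc (double l))))) ≡
  bit (t (suc (double a))) * suc (double l) + (l * l + ones (window (suc a) l))
moment-one-window-odd-even a l = trans (moment-one-window-odd a (suc (double l)))
  (cong (bit (t (suc (double a))) * suc (double l) +_) (moment-one-window-even-odd (suc a) l))

bit-digit : ∀ x y {c s a b} → bit x * c + (s + a) ≡ bit y * c + (s + b) → a < c → b < c → x ≡ y
bit-digit false false _ _ _ = refl
bit-digit true true _ _ _ = refl
bit-digit true false {c} {s} {a} {b} eq _ b<c = ⊥-elim (<⇒≢ (carry b<c) (sym eq))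
  where
  carry : b < c → s + b < 1 * c + (s + a)
  carry b<c = begin-strict
    s + b            <⟨ +-monoʳ-< s b<c ⟩
    s + c            ≤⟨ m≤m+n (s + c) a ⟩
    s + c + a        ≡⟨ regroup s c a ⟩
    1 * c + (s + a)  ∎
    where
    open ≤-Reasoning
    regroup : ∀ s c a → s + c + a ≡ 1 * c + (s + a)
    regroup = solve-∀
bit-digit false true eq a<c b<c = sym (bit-digit true false (sym eq) b<c a<c)

bit-separation : ∀ z x {m a b c} → m + bit z + a ≡ bit x * c + b → m + a < c → b ≤ m → z ≡ x
bit-separation false false _ _ _ = refl
bit-separation true true _ _ _ = refl
bit-separation false true {m} {a} {b} {c} eq m+a<c _ = ⊥-elim (<⇒≢ below eq)
  where
  below : m + 0 + a < 1 * c + b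
  below = begin-strict
    m + 0 + a  ≡⟨ cong (_+ a) (+-identityʳ m) ⟩
    m + a      <⟨ m+a<c ⟩
    c          ≤⟨ m≤m+n c (0 * c + b) ⟩
    c + (0 * c + b)  ≡⟨ +-assoc c (0 * c) b ⟨
    1 * c + b  ∎
    where open ≤-Reasoning
bit-separation true false {m} {a} {b} {c} eq _ b≤m = ⊥-elim (<⇒≢ below (sym eq))
  where
  below : 0 * c + b < m + 1 + a
  below = begin-strict
    b          ≤⟨ b≤m ⟩
    m          <⟨ m<m+n m z<s ⟩
    m + 1      ≤⟨ m≤m+n (m + 1) a ⟩
    m + 1 + a  ∎
    where open ≤-Reasoning

≤⇒<suc-double : ∀ {a l} → a ≤ l → l + a < suc (double l)
≤⇒<suc-double {a} {l} a≤l = s≤s (subst (l + a ≤_) (sym (double≡+ l)) (+-monoʳ-≤ l a≤l))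

head-from-moment-odd-odd-even : ∀ a b l →
  moment 1 (bits (window (suc (double a)) (suc (suc (double l))))) ≡ moment 1 (bits (window (suc (double b)) (suc (suc (double l))))) →
  t (suc (double a)) ≡ t (suc (double b))
head-from-moment-odd-odd-even a b l eq =
  bit-digit _ _ (trans (sym (moment-one-window-odd-even a l)) (trans eq (moment-one-window-odd-even b l)))
    (ones<suc-double a) (ones<suc-double b)
  where
  ones<suc-double : ∀ p → ones (window (suc p) l) < suc (double l)
  ones<suc-double p = ≤-<-trans (m≤n+m _ l) (≤⇒<suc-double (ones-window≤ (suc p) l))

head-from-moment-even-odd-odd : ∀ a b l → let m = suc l in
  moment 1 (bits (window (double a) (suc (double m)))) ≡ moment 1 (bits (window (suc (double b)) (suc (double m)))) →
  t (double a) ≡ t (suc (double b))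
head-from-moment-even-odd-odd a b l eq = trans (t-double a)
  (bit-separation (t a) y (+-cancelˡ-≡ (m * m) _ _ balance) m+A<double-m (ones-window≤ (suc b) m))
  where
  open ≡-Reasoning
  m A : ℕ
  m = suc l
  A = ones (window (suc a) l)
  y : Bool
  y = t (suc (double b))
  m+A<double-m : m + A < double m
  m+A<double-m = subst (m + A <_) (sym (double≡+ m))
    (subst (_≤ m + m) (+-suc m A) (+-monoʳ-≤ m (s≤s (ones-window≤ (suc a) l))))
  balance : m * m + (m + bit (t a) + A) ≡ m * m + (bit y * double m + ones (window (suc b) m))
  balance = begin
    m * m + (m + bit (t a) + A)                               ≡⟨ regroup (m * m) m (bit (t a)) A ⟩
    m * m + (bit (t a) + A) + m                               ≡⟨ cong (λ o → m * m + o + m) (ones-∷ (t a) (window (suc a) l)) ⟨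
    m * m + ones (window a m) + m                             ≡⟨ cong (_+ m) (moment-one-window-even-odd a m) ⟨
    moment 1 (bits (window (double a) (suc (double m)))) + m  ≡⟨ cong (_+ m) eq ⟩
    moment 1 (bits (window (suc (double b)) (suc (double m)))) + m  ≡⟨ moment-one-window-odd-odd b m ⟩
    bit y * double m + (m * m + ones (window (suc b) m))      ≡⟨ x∙yz≈y∙xz (bit y * double m) (m * m) _ ⟩
    m * m + (bit y * double m + ones (window (suc b) m))      ∎
    where
    regroup : ∀ s m z a → s + (m + z + a) ≡ s + (z + a) + m
    regroup = solve-∀

head-from-moment-even-odd-even : ∀ a b l → let m = suc l in
  moment 1 (bits (window (double a) (double m))) ≡ moment 1 (bits (window (suc (double b)) (double m))) →
  t (double a) ≡ t (suc (double b))
head-from-moment-even-odd-even a b l eq = trans (t-double a)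
  (bit-separation (t a) y (+-cancelˡ-≡ (l * l) _ _ (+-cancelʳ-≡ m _ _ balance))
    (≤⇒<suc-double (ones-window≤ (suc a) l)) (ones-window≤ (suc b) l))
  where
  open ≡-Reasoning
  m A B : ℕ
  m = suc l
  A = ones (window (suc a) l)
  B = ones (window (suc b) l)
  y : Bool
  y = t (suc (double b))
  balance : l * l + (l + bit (t a) + A) + m ≡ l * l + (bit y * suc (double l) + B) + m
  balance = begin
    l * l + (l + bit (t a) + A) + m                          ≡⟨ square l (bit (t a)) A ⟩
    m * m + (bit (t a) + A)                                  ≡⟨ cong (m * m +_) (ones-∷ (t a) (window (suc a) l)) ⟨
    m * m + ones (window a m)                                ≡⟨ moment-one-window-double a m ⟨
    moment 1 (bits (window (double a) (double m))) + m       ≡⟨ cong (_+ m) eq ⟩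
    moment 1 (bits (window (suc (double b)) (double m))) + m ≡⟨ cong (_+ m) (moment-one-window-odd-even b l) ⟩
    bit y * suc (double l) + (l * l + B) + m                 ≡⟨ cong (_+ m) (x∙yz≈y∙xz (bit y * suc (double l)) (l * l) B) ⟩
    l * l + (bit y * suc (double l) + B) + m                 ∎
    where
    square : ∀ l z a → l * l + (l + z + a) + suc l ≡ suc l * suc l + (z + a)
    square = solve-∀

length-bits-window : ∀ p n → length (bits (window p n)) ≡ n
length-bits-window p n = trans (length-map bit (window p n)) (length-window p n)

bits-window-∷ʳ : ∀ p n → bits (window p (suc n)) ≡ bits (window p n) ∷ʳ bit (t (p + n))
bits-window-∷ʳ p n = trans (cong bits (window-∷ʳ p n)) (map-++ bit (window p n) (t (p + n) ∷ []))

momentsAgree-window-tail : ∀ {k} p q n → t p ≡ t q →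
  MomentsAgree k (bits (window p (suc n))) (bits (window q (suc n))) →
  MomentsAgree k (bits (window (suc p) n)) (bits (window (suc q) n))
momentsAgree-window-tail {k} p q n head≡ agree = momentsAgree-∷⁻ (bit (t p)) (bits (window (suc p) n)) (bits (window (suc q) n))
  (trans (length-bits-window (suc p) n) (sym (length-bits-window (suc q) n)))
  (subst (λ x → MomentsAgree k (bits (window p (suc n))) (bit x ∷ bits (window (suc q) n))) (sym head≡) agree)

momentsAgree-window-init : ∀ {k} p q n → t (p + n) ≡ t (q + n) →
  MomentsAgree k (bits (window p (suc n))) (bits (window q (suc n))) →
  MomentsAgree k (bits (window p n)) (bits (window q n))
momentsAgree-window-init {k} p q n last≡ agree = momentsAgree-∷ʳ⁻ (bits (window p n)) (bits (window q n)) (bit (t (p + n)))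
  (subst₂ (MomentsAgree k) (bits-window-∷ʳ p n)
    (trans (bits-window-∷ʳ q n) (cong (λ x → bits (window q n) ∷ʳ bit x) (sym last≡))) agree)

momentsAgree-two-windows : ∀ k p q n → n < 2 ^ k →
  MomentsAgree k (bits (window p n)) (bits (window q n)) → MomentsAgree 2 (bits (window p n)) (bits (window q n))
momentsAgree-two-windows k p q n n<2^k = momentsAgree-two k (bits (window p n)) (bits (window q n))
  (subst (_< 2 ^ k) (sym (length-bits-window p n)) n<2^k) (subst (_< 2 ^ k) (sym (length-bits-window q n)) n<2^k)

window-one-determined : ∀ p q → ones (window p 1) ≡ ones (window q 1) → t p ≡ t q
window-one-determined p q eq = bit-injective (trans (sym (ones-singleton p)) (trans eq (ones-singleton q)))
  where
  ones-singleton : ∀ p → ones (window p 1) ≡ bit (t p)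
  ones-singleton p = trans (+-identityʳ (bit (t p) * 1)) (*-identityʳ (bit (t p)))

mutual
  window-determined : ∀ k n p q → n < 2 ^ k →
    MomentsAgree k (bits (window p n)) (bits (window q n)) → window p n ≡ window q n
  window-determined k zero p q _ _ = refl
  window-determined k (suc n) p q n<2^k agree with t p ≟ t q | t (p + n) ≟ t (q + n)
  ... | yes head≡ | _ = cong₂ _∷_ head≡
    (window-determined k n (suc p) (suc q) (<⇒≤ n<2^k) (momentsAgree-window-tail p q n head≡ agree))
  ... | no _ | yes last≡ = begin
    window p (suc n)        ≡⟨ window-∷ʳ p n ⟩
    window p n ∷ʳ t (p + n) ≡⟨ cong₂ _∷ʳ_ initsEqual last≡ ⟩
    window q n ∷ʳ t (q + n) ≡⟨ window-∷ʳ q n ⟨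
    window q (suc n)        ∎
    where
    open ≡-Reasoning
    initsEqual : window p n ≡ window q n
    initsEqual = window-determined k n p q (<⇒≤ n<2^k) (momentsAgree-window-init p q n last≡ agree)
  ... | no head≢ | no last≢ =
    ends-differ k n p q n<2^k agree (momentsAgree-two-windows k p q (suc n) n<2^k agree) head≢ last≢

  ends-differ : ∀ k n p q → suc n < 2 ^ k →
    MomentsAgree k (bits (window p (suc n))) (bits (window q (suc n))) →
    MomentsAgree 2 (bits (window p (suc n))) (bits (window q (suc n))) →
    t p ≢ t q → t (p + n) ≢ t (q + n) → window p (suc n) ≡ window q (suc n)
  ends-differ k n p q n<2^k agree agree₂ head≢ last≢ with parity p | parity q | parity n
  ... | even a | even b | even l = ⊥-elim (last≢ (bit-injective (+-cancelˡ-≡ l _ _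
    (trans (sym (ones-window-even-odd a l)) (trans (agree₂ 0 z<s) (ones-window-even-odd b l))))))
  ... | odd a | odd b | even l = ⊥-elim (head≢ (bit-injective (+-cancelʳ-≡ l _ _
    (trans (sym (ones-window-odd-odd a l)) (trans (agree₂ 0 z<s) (ones-window-odd-odd b l))))))
  ... | even a | even b | odd l = even-aligned k a b (suc l) n<2^k agree
  ... | odd a | odd b | odd l = ⊥-elim (head≢ (head-from-moment-odd-odd-even a b l (agree₂ 1 (s≤s (s≤s z≤n)))))
  ... | even a | odd b | even zero = ⊥-elim (head≢ (window-one-determined p q (agree₂ 0 z<s)))
  ... | odd a | even b | even zero = ⊥-elim (head≢ (window-one-determined p q (agree₂ 0 z<s)))
  ... | even a | odd b | even (suc l) =
    ⊥-elim (head≢ (head-from-moment-even-odd-odd a b l (agree₂ 1 (s≤s (s≤s z≤n)))))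
  ... | odd a | even b | even (suc l) =
    ⊥-elim (head≢ (sym (head-from-moment-even-odd-odd b a l (sym (agree₂ 1 (s≤s (s≤s z≤n)))))))
  ... | even a | odd b | odd l =
    ⊥-elim (head≢ (head-from-moment-even-odd-even a b l (agree₂ 1 (s≤s (s≤s z≤n)))))
  ... | odd a | even b | odd l =
    ⊥-elim (head≢ (sym (head-from-moment-even-odd-even b a l (sym (agree₂ 1 (s≤s (s≤s z≤n)))))))

  even-aligned : ∀ k a b m → double m < 2 ^ k →
    MomentsAgree k (bits (window (double a) (double m))) (bits (window (double b) (double m))) →
    window (double a) (double m) ≡ window (double b) (double m)
  even-aligned zero a b zero _ _ = refl
  even-aligned zero a b (suc m) (s≤s ())
  even-aligned (suc k) a b m double-m<2^k agree = begin
    window (double a) (double m)  ≡⟨ window-double a m ⟩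
    φ (window a m)                ≡⟨ cong φ (window-determined k m a b m<2^k halvesAgree) ⟩
    φ (window b m)                ≡⟨ window-double b m ⟨
    window (double b) (double m)  ∎
    where
    open ≡-Reasoning
    m<2^k : m < 2 ^ k
    m<2^k = double-cancel-< (subst (double m <_) (2^suc≡double k) double-m<2^k)
    halvesAgree : MomentsAgree k (bits (window a m)) (bits (window b m))
    halvesAgree = momentsAgree-φ⁻ k (window a m) (window b m) (trans (length-window a m) (sym (length-window b m)))
      (subst₂ (MomentsAgree (suc k)) (cong bits (window-double a m)) (cong bits (window-double b m)) agree)

proposition8p1 : (k : ℕ) → 3 ≤ k → (u v : List Bool) →
    IsFactor u → IsFactor v → u ≢ v → length u ≡ length v →
    length u ≤ 2 ^ k ∸ 1 →
    ¬ CommonPrefix u v → ¬ CommonSuffix u v →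
    ¬ (u ∼[ k ] v)
proposition8p1 k _ u v (p , u≡) (q , v≡) u≢v |u|≡|v| |u|≤2^k∸1 _ _ u∼v = u≢v (begin
  u           ≡⟨ u≡window ⟩
  window p n  ≡⟨ window-determined k n p q n<2^k windowsAgree ⟩
  window q n  ≡⟨ v≡window ⟨
  v           ∎)
  where
  open ≡-Reasoning
  n : ℕ
  n = length u
  u≡window : u ≡ window p n
  u≡window = trans u≡ (factorAt≡window p n)
  v≡window : v ≡ window q n
  v≡window = trans v≡ (trans (cong (factorAt q) (sym |u|≡|v|)) (factorAt≡window q n))
  windowsAgree : MomentsAgree k (bits (window p n)) (bits (window q n))
  windowsAgree = subst₂ (MomentsAgree k) (cong bits u≡window) (cong bits v≡window) (∼⇒momentsAgree u∼v)
  n<2^k : n < 2 ^ k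
  n<2^k = subst (_≤ 2 ^ k) (+-comm n 1) (m≤o∸n⇒m+n≤o n (m^n>0 2 k) |u|≤2^k∸1)
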